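{- Let $b,h,d\ge1$ be integers, let $D'$ be a digraph and $v\in V(D')$. Suppose that (1) every vertex of $D'$ reachable from $v$ has out-degree at least $(h+1)\cdot(d(2b-2)+1)+d$, and (2) the number of vertices of $D'$ at distance at most $(h+1)(2b-1)$ from $v$ is less than $d^h$. Then $D'$ contains a type-III gadget $G$ and a directed path $P_0$ from $v$ to $p(G)$ such that $V(P_0)\cap V(G)=\{p(G)\}$, $|V(G)|\le(2h+2)(2b-1)$ and $|V(P_0)|\le h(2b-1)$.
   Context: Digraphs are finite, loopless, without parallel arcs. The distance from $v$ to $u$ is the length of a shortest directed $v$-$u$ path. A type-III gadget $G$ (with parameter $b$) consists of vertices $p=p(G)$, $q=q(G)$, $r$, the arc $(p,q)$, and two internally vertex-disjoint directed paths from $p$ and from $q$ respectively to $r$, each of length at least $2b-1$. -}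

module Defs where

open import Data.Nat using (ℕ; zero; suc; _+_; _*_; _∸_; _≤_; _<_)
open import Data.Fin using (Fin)
open import Data.Bool using (Bool; true; false; if_then_else_)
open import Data.List using (List; length; head; last; allFin; map)
open import Data.Nat.ListAction using (sum)
open import Data.List.Membership.Propositional using (_∈_)
open import Data.List.Relation.Unary.All using (All)
open import Data.List.Relation.Unary.Linked using (Linked)
open import Data.List.Relation.Unary.Unique.Propositional using (Unique)
open import Data.Maybe using (just)
open import Data.Product using (Σ; ∃; _×_; _,_)
open import Data.Sum using (_⊎_)
open import Relation.Binary.PropositionalEquality using (_≡_)

record Digraph : Set where
  field
    n        : ℕ
    arc      : Fin n → Fin n → Bool
    loopless : ∀ v → arc v v ≡ false

open Digraph public

Vertex : Digraph → Set
Vertex D = Fin (n D)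

Arc : (D : Digraph) → Vertex D → Vertex D → Set
Arc D u w = arc D u w ≡ true

outdeg : (D : Digraph) → Vertex D → ℕ
outdeg D v = sum (map (λ u → if arc D v u then 1 else 0) (allFin (n D)))

record Path (D : Digraph) (x y : Vertex D) : Set where
  field
    verts  : List (Vertex D)
    linked : Linked (Arc D) verts
    unique : Unique verts
    start  : head verts ≡ just x
    end    : last verts ≡ just y

open Path public

nverts : ∀ {D x y} → Path D x y → ℕ
nverts P = length (verts P)

plen : ∀ {D x y} → Path D x y → ℕ
plen P = nverts P ∸ 1

_∈P_ : ∀ {D x y} → Vertex D → Path D x y → Set
u ∈P P = u ∈ verts P

Reachable : (D : Digraph) → Vertex D → Vertex D → Set
Reachable D v u = Path D v u

DistLe : (D : Digraph) → Vertex D → Vertex D → ℕ → Set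
DistLe D v u k = Σ (Path D v u) λ P → plen P ≤ k

FewerThan : (D : Digraph) → (Vertex D → Set) → ℕ → Set
FewerThan D S m = (xs : List (Vertex D)) → Unique xs → All S xs → length xs < m

record GadgetIII (D : Digraph) (b : ℕ) : Set where
  field
    p q r   : Vertex D
    pq      : Arc D p q
    P₁      : Path D p r
    P₂      : Path D q r
    disj    : ∀ u → u ∈P P₁ → u ∈P P₂ → u ≡ r
    len₁    : 2 * b ∸ 1 ≤ plen P₁
    len₂    : 2 * b ∸ 1 ≤ plen P₂

open GadgetIII public

_∈G_ : ∀ {D b} → Vertex D → GadgetIII D b → Set
u ∈G G = u ∈P P₁ G ⊎ u ∈P P₂ G

-- |V(G)| = |V(P₁)| + |V(P₂)| - 1 (they share exactly r)
gsize : ∀ {D b} → GadgetIII D b → ℕ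
gsize G = nverts (P₁ G) + nverts (P₂ G) ∸ 1

module Submission where

-- Write L = 2b-1 = M+1.  From v we grow a tree of height h: at each node x we
-- greedily grow d branches, paths of L arcs from x that are pairwise disjoint
-- and avoid a forbidden set F (the stem from v to x and the interiors of the
-- branches above).  A level adds dM+1 vertices to F, and the out-degree bound
-- (h+1)(dM+1)+d is just what keeps greedy growth possible up to height h.  By
-- induction, a node of height k either yields the gadget or reaches d^k
-- distinct vertices by F-avoiding routes of at most kL arcs: if the subtrees
-- of two branches β₁, β₂ reach a common vertex, cut the two routes from x at
-- their first common vertex r.  Then r is off both branch interiors and off
-- at least one branch, so the two segments are internally disjoint x–r paths
-- with at least L and at least L+1 arcs: a gadget with p = x.  At the root the
-- d^h targets would lie within distance hL of v, contradicting the hypothesis.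

open import Defs
open import Data.Nat using (ℕ; zero; suc; _+_; _*_; _∸_; _^_; _≤_; _<_; z≤n; s≤s)
open import Data.Nat.Properties
  using (≤-refl; ≤-trans; ≤-reflexive; ≤-pred; <⇒≱; +-assoc; +-comm; +-mono-≤; +-monoʳ-≤; +-monoˡ-≤;
         *-monoˡ-≤; *-monoʳ-≤; m≤m+n; m≤n+m; n≤1+n; module ≤-Reasoning)
open import Data.Nat.Solver using (module +-*-Solver)
open import Data.Bool using (Bool; true; false; if_then_else_)
open import Data.Fin.Properties using (_≟_)
open import Data.Empty using (⊥-elim)
open import Data.Product using (Σ; ∃; _×_; _,_; proj₁; proj₂)
open import Data.Sum as Sum using (_⊎_; inj₁; inj₂)
open import Data.List using (List; []; _∷_; _++_; [_]; length; map; concatMap; allFin; last)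
open import Data.List.Properties using (++-assoc; length-++; length-map; ∷-injectiveˡ; ∷-injectiveʳ)
open import Data.Nat.ListAction using (sum)
open import Data.List.Membership.Propositional using (_∈_; _∉_; find; lose)
open import Data.List.Membership.Propositional.Properties
  using (∈-++⁺ˡ; ∈-++⁺ʳ; ∈-++⁻; ∈-∃++; ∈-map⁺; ∈-concat⁺′)
import Data.List.Membership.DecPropositional as DecMembership
open import Data.List.Relation.Unary.Any using (here; there; _─_; any?)
open import Data.List.Relation.Unary.All as All using (All; []; _∷_)
import Data.List.Relation.Unary.All.Properties as AllP
open import Data.List.Relation.Unary.AllPairs as AllPairs using (AllPairs; []; _∷_)
import Data.List.Relation.Unary.AllPairs.Properties as AllPairsP
open import Data.List.Relation.Unary.Linked using (Linked; [-]; _∷_)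
open import Data.List.Relation.Unary.Unique.Propositional using (Unique)
import Data.List.Relation.Unary.Unique.Propositional.Properties as UniqueP
import Data.List.Relation.Unary.First as First
open import Data.List.Relation.Unary.First.Properties using (toView)
open import Data.List.Relation.Binary.Disjoint.Propositional using (Disjoint)
import Data.List.Relation.Binary.Disjoint.Propositional.Properties as DisjointP
open import Data.Maybe using (just)
open import Relation.Binary.PropositionalEquality
  using (_≡_; _≢_; refl; sym; trans; cong; cong₂; subst)
open import Relation.Binary.Definitions using (DecidableEquality)
open import Relation.Nullary using (Dec; yes; no)
open import Relation.Nullary.Decidable using (toSum)

module _ {A : Set} where

  length-─ : ∀ {x : A} {xs} (p : x ∈ xs) → length xs ≡ suc (length (xs ─ p))
  length-─ (here _) = refl
  length-─ {xs = _ ∷ _} (there p) = cong suc (length-─ p)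

  ∈-─ : ∀ {x y : A} {xs} (p : x ∈ xs) → y ∈ xs → y ≢ x → y ∈ (xs ─ p)
  ∈-─ (here refl) (here refl) y≢x = ⊥-elim (y≢x refl)
  ∈-─ (here _) (there q) _ = q
  ∈-─ (there p) (here refl) _ = here refl
  ∈-─ (there p) (there q) y≢x = there (∈-─ p q y≢x)

  count : (A → Bool) → List A → ℕ
  count f xs = sum (map (λ u → if f u then 1 else 0) xs)

  unique-++ˡ : ∀ {xs ys : List A} → Unique (xs ++ ys) → Unique xs
  unique-++ˡ {[]} _ = []
  unique-++ˡ {x ∷ xs} (x∉ ∷ u) = AllP.++⁻ˡ xs x∉ ∷ unique-++ˡ u

  split-at : ∀ (pre : List A) r post → pre ++ r ∷ post ≡ (pre ++ [ r ]) ++ post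
  split-at pre r post = sym (++-assoc pre [ r ] post)

  length-snoc : ∀ (pre : List A) r → length (pre ++ [ r ]) ≡ suc (length pre)
  length-snoc pre r = trans (length-++ pre) (+-comm (length pre) 1)

  ∈-snoc : ∀ {u : A} pre {r} → u ∈ pre ++ [ r ] → u ∈ pre ⊎ u ≡ r
  ∈-snoc pre m with ∈-++⁻ pre m
  ... | inj₁ u∈pre = inj₁ u∈pre
  ... | inj₂ (here u≡r) = inj₂ u≡r

  prefix-beyond : ∀ (I rest pre post : List A) {r} → I ++ rest ≡ pre ++ r ∷ post → r ∉ I →
                  suc (length I) ≤ length (pre ++ [ r ])
  prefix-beyond I rest pre post {r} eq r∉I =
    ≤-trans (s≤s (beyond I pre eq r∉I)) (≤-reflexive (sym (length-snoc pre r)))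
    where
      beyond : ∀ I pre → I ++ rest ≡ pre ++ r ∷ post → r ∉ I → length I ≤ length pre
      beyond [] _ _ _ = z≤n
      beyond (i ∷ I) [] eq r∉I = ⊥-elim (r∉I (here (sym (∷-injectiveˡ eq))))
      beyond (i ∷ I) (_ ∷ pre) eq r∉I = s≤s (beyond I pre (∷-injectiveʳ eq) (λ m → r∉I (there m)))

  length-concatMap : ∀ {B : Set} (f : B → List A) {m} → (∀ y → length (f y) ≡ m) →
                     ∀ ys → length (concatMap f ys) ≡ length ys * m
  length-concatMap f same [] = refl
  length-concatMap f same (y ∷ ys) =
    trans (length-++ (f y)) (cong₂ _+_ (same y) (length-concatMap f same ys))

  disjoint-⊆ʳ : ∀ {xs F B : List A} → Disjoint xs B → (∀ {u} → u ∈ F → u ∈ B) → Disjoint xs F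
  disjoint-⊆ʳ xs#B F⊆B (u∈xs , u∈F) = xs#B (u∈xs , F⊆B u∈F)

  ∈-concatMap : ∀ {B : Set} (f : B → List A) {y ys u} → y ∈ ys → u ∈ f y → u ∈ concatMap f ys
  ∈-concatMap f y∈ u∈ = ∈-concat⁺′ u∈ (∈-map⁺ f y∈)

module _ {A : Set} (_≟ᴬ_ : DecidableEquality A) where
  open DecMembership _≟ᴬ_ using (_∈?_)

  fresh : (f : A → Bool) (xs B : List A) → Unique xs → length B < count f xs →
          ∃ λ u → u ∈ xs × f u ≡ true × u ∉ B
  fresh f (x ∷ xs) B (x∉xs ∷ uxs) lt with f x in fx
  ... | false with fresh f xs B uxs lt
  ...   | u , u∈ , fu , u∉B = u , there u∈ , fu , u∉B
  fresh f (x ∷ xs) B (x∉xs ∷ uxs) lt | true with x ∈? B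
  ...   | no x∉B = x , here refl , fx , x∉B
  ...   | yes x∈B with fresh f xs (B ─ x∈B) uxs (≤-pred (subst (λ m → suc m ≤ _) (length-─ x∈B) lt))
  ...     | u , u∈ , fu , u∉ =
    u , there u∈ , fu , λ u∈B → u∉ (∈-─ x∈B u∈B (λ u≡x → All.lookup x∉xs u∈ (sym u≡x)))

  record FirstCommon (xs ys : List A) : Set where
    field
      common : A
      preX postX preY postY : List A
      splitX : xs ≡ preX ++ common ∷ postX
      splitY : ys ≡ preY ++ common ∷ postY
      early : All (_∉ xs) preY

  firstCommon : ∀ {z} (xs ys : List A) → z ∈ xs → z ∈ ys → FirstCommon xs ys
  firstCommon xs ys z∈xs z∈ys with First.first (λ u → Sum.swap (toSum (u ∈? xs))) ys
  ... | inj₂ none = ⊥-elim (All.lookup none z∈ys z∈xs)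
  ... | inj₁ found with toView found
  ...   | First._++_∷_ early c∈xs postY with ∈-∃++ c∈xs
  ...     | preX , postX , splitX = record
    { common = _ ; preX = preX ; postX = postX ; preY = _ ; postY = postY
    ; splitX = splitX ; splitY = refl ; early = early }

  keyClash : ∀ {X Y : Set} (f : X → A) (g : Y → A) (xs : List X) (ys : List Y) →
             (∃ λ x → ∃ λ y → f x ≡ g y) ⊎ All (λ x → All (λ y → f x ≢ g y) ys) xs
  keyClash f g [] ys = inj₂ []
  keyClash f g (x ∷ xs) ys with keyClash f g xs ys | any? (λ y → f x ≟ᴬ g y) ys
  ... | inj₁ clash | _ = inj₁ clash
  ... | inj₂ _ | yes hit = let (y , _ , e) = find hit in inj₁ (x , y , e)
  ... | inj₂ apart | no miss =
    inj₂ (All.tabulate (λ y∈ e → miss (lose y∈ e)) ∷ apart)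

2b∸1≡suc : ∀ b → 1 ≤ b → 2 * b ∸ 1 ≡ suc (2 * b ∸ 2)
2b∸1≡suc b b≥1 = pred≡suc∘pred₂ (*-monoʳ-≤ 2 b≥1)
  where
    pred≡suc∘pred₂ : ∀ {m} → 2 ≤ m → m ∸ 1 ≡ suc (m ∸ 2)
    pred≡suc∘pred₂ (s≤s (s≤s _)) = refl

open +-*-Solver

-- The out-degree budget: while fewer than d branches of M+1 vertices have been
-- grown and the forbidden set f leaves room for a level, f, these branches and
-- the branch being grown (M+1 vertices) stay below (h+1)(dM+1)+d.
branch-room : ∀ f t d M h → suc t ≤ d → f + (d * M + 1) ≤ h * (d * M + 1) →
              f + t * suc M + suc M < (h + 1) * (d * M + 1) + d
branch-room f t d M h t<d f-room = begin-strict
    f + t * suc M + suc M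
  ≡⟨ solve 3 (λ f t M → f :+ t :* (con 1 :+ M) :+ (con 1 :+ M)
                      := f :+ (con 1 :+ t) :* (con 1 :+ M)) refl f t M ⟩
    f + suc t * suc M
  ≤⟨ +-monoʳ-≤ f (*-monoˡ-≤ (suc M) t<d) ⟩
    f + d * suc M
  <⟨ s≤s ≤-refl ⟩
    suc (f + d * suc M)
  ≡⟨ solve 3 (λ f d M → con 1 :+ (f :+ d :* (con 1 :+ M)) := f :+ (d :* M :+ con 1) :+ d) refl f d M ⟩
    f + (d * M + 1) + d
  ≤⟨ +-monoˡ-≤ d (≤-trans f-room (*-monoˡ-≤ (d * M + 1) (m≤m+n h 1))) ⟩
    (h + 1) * (d * M + 1) + d
  ∎
  where open ≤-Reasoning

gadget-size : ∀ h L a c → a ≤ h * L → c ≤ h * L → a + c ≤ (2 * h + 2) * L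
gadget-size h L a c a≤ c≤ = begin
    a + c
  ≤⟨ +-mono-≤ a≤ c≤ ⟩
    h * L + h * L
  ≤⟨ m≤m+n (h * L + h * L) (2 * L) ⟩
    h * L + h * L + 2 * L
  ≡⟨ solve 2 (λ h L → h :* L :+ h :* L :+ con 2 :* L := (con 2 :* h :+ con 2) :* L) refl h L ⟩
    (2 * h + 2) * L
  ∎
  where open ≤-Reasoning

module Paths (D : Digraph) where

  V : Set
  V = Vertex D

  data Walk : V → V → List V → Set where
    stop : ∀ {x} → Walk x x []
    _◅_  : ∀ {x w y ws} → Arc D x w → Walk w y ws → Walk x y (w ∷ ws)

  -- A path from x to y; vs lists its vertices after x.
  record SimplePath (x y : V) : Set where
    constructor simple
    field
      vs       : List V
      walk     : Walk x y vs
      distinct : Unique (x ∷ vs)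

  open SimplePath public

  walk-linked : ∀ {x y ws} → Walk x y ws → Linked (Arc D) (x ∷ ws)
  walk-linked stop = [-]
  walk-linked (a ◅ w) = a ∷ walk-linked w

  walk-last : ∀ {x y ws} → Walk x y ws → last (x ∷ ws) ≡ just y
  walk-last stop = refl
  walk-last (a ◅ stop) = refl
  walk-last (a ◅ (b ◅ w)) = walk-last (b ◅ w)

  walk-end : ∀ {x y ws} → Walk x y ws → y ∈ x ∷ ws
  walk-end stop = here refl
  walk-end (_ ◅ w) = there (walk-end w)

  _++ʷ_ : ∀ {x y z vs ws} → Walk x y vs → Walk y z ws → Walk x z (vs ++ ws)
  stop ++ʷ w = w
  (a ◅ w₁) ++ʷ w = a ◅ (w₁ ++ʷ w)

  toPath : ∀ {x y} → SimplePath x y → Path D x y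
  toPath P = record { verts = _ ∷ vs P ; linked = walk-linked (walk P) ; unique = distinct P
                    ; start = refl ; end = walk-last (walk P) }

  trivial : ∀ {x} → SimplePath x x
  trivial = simple [] stop ([] ∷ [])

  start∉ : ∀ {x y} (P : SimplePath x y) → x ∉ vs P
  start∉ P x∈ = All.lookup (AllPairs.head (distinct P)) x∈ refl

  join : ∀ {x y z} (P : SimplePath x y) (Q : SimplePath y z) → Disjoint (x ∷ vs P) (vs Q) → SimplePath x z
  join P Q P#Q =
    simple (vs P ++ vs Q) (walk P ++ʷ walk Q) (UniqueP.++⁺ (distinct P) (AllPairs.tail (distinct Q)) P#Q)

  end∈join : ∀ {x y z} (P : SimplePath x y) (Q : SimplePath y z) → y ∈ vs P → z ∈ vs P ++ vs Q
  end∈join P Q y∈P with walk-end (walk Q)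
  ... | here refl = ∈-++⁺ˡ y∈P
  ... | there z∈Q = ∈-++⁺ʳ (vs P) z∈Q

  -- Digraphs are loopless, so an arc is a path.
  edge : ∀ {x y} → Arc D x y → SimplePath x y
  edge {x} a = simple [ _ ] (a ◅ stop) ((x≢ a ∷ []) ∷ [] ∷ [])
    where
      x≢ : ∀ {y} → Arc D x y → x ≢ y
      x≢ a refl with trans (sym a) (loopless D x)
      ... | ()

  extend : ∀ {x w u} (P : SimplePath x w) → Arc D w u → u ∉ x ∷ vs P → SimplePath x u
  extend P a u∉ = join P (edge a) λ { (u∈ , here refl) → u∉ u∈ }

  walk-prefix : ∀ {x z r} pre {post} → Walk x z (pre ++ r ∷ post) → Walk x r (pre ++ [ r ])
  walk-prefix [] (a ◅ _) = a ◅ stop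
  walk-prefix (_ ∷ pre) (a ◅ w) = a ◅ walk-prefix pre w

  prefix : ∀ {x z r pre post} (P : SimplePath x z) → vs P ≡ pre ++ r ∷ post → SimplePath x r
  prefix {x} {z} {r} {pre} {post} P e =
    simple (pre ++ [ r ]) (walk-prefix pre (subst (Walk x z) e (walk P)))
      (unique-++ˡ (subst Unique (split-at (x ∷ pre) r post) (subst (λ l → Unique (x ∷ l)) e (distinct P))))

  prefix-⊆ : ∀ {x z r pre post} (P : SimplePath x z) (e : vs P ≡ pre ++ r ∷ post) →
             ∀ {u} → u ∈ vs (prefix P e) → u ∈ vs P
  prefix-⊆ {r = r} {pre} {post} P e u∈ =
    subst (_ ∈_) (sym (trans e (split-at pre r post))) (∈-++⁺ˡ u∈)

  prefix-≤ : ∀ {x z r pre post} (P : SimplePath x z) (e : vs P ≡ pre ++ r ∷ post) →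
             length (vs (prefix P e)) ≤ length (vs P)
  prefix-≤ {r = r} {pre} {post} P e =
    subst (length (pre ++ [ r ]) ≤_)
      (sym (trans (cong length (trans e (split-at pre r post))) (length-++ (pre ++ [ r ]))))
      (m≤m+n _ _)

  outNeighbourOff : ∀ {w} (B : List V) → length B < outdeg D w → ∃ λ u → Arc D w u × u ∉ B
  outNeighbourOff {w} B lt with fresh _≟_ (arc D w) (allFin (n D)) B (UniqueP.allFin⁺ (n D)) lt
  ... | u , _ , a , u∉ = u , a , u∉

  extendOff : ∀ {x w} (B : List V) (P : SimplePath x w) → Disjoint (vs P) B →
              length B + suc (length (vs P)) < outdeg D w →
              Σ V λ u → Σ (SimplePath x u) λ P′ → vs P′ ≡ vs P ++ [ u ] × Disjoint (vs P′) B
  extendOff {x} B P P#B room with outNeighbourOff (B ++ x ∷ vs P) (subst (_< _) (sym (length-++ B)) room)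
  ... | u , a , u∉ = u , extend P a (λ u∈ → u∉ (∈-++⁺ʳ B u∈)) , refl , off
    where
      off : Disjoint (vs P ++ [ u ]) B
      off (v∈ , v∈B) with ∈-snoc (vs P) v∈
      ... | inj₁ v∈P = P#B (v∈P , v∈B)
      ... | inj₂ refl = u∉ (∈-++⁺ˡ v∈B)

  greedyPath : ∀ {x} (B : List V) (m : ℕ) →
               (∀ {w} (P : SimplePath x w) → Disjoint (vs P) B → length B + m < outdeg D w) →
               Σ V λ w → Σ (SimplePath x w) λ P → Disjoint (vs P) B × length (vs P) ≡ m
  greedyPath B zero _ = _ , trivial , (λ { (() , _) }) , refl
  greedyPath B (suc m) room with greedyPath B m (λ P P#B → ≤-trans (s≤s (+-monoʳ-≤ (length B) (n≤1+n m))) (room P P#B))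
  ... | w , P , P#B , refl with extendOff B P P#B (room P P#B)
  ...   | u , P′ , grown , P′#B = u , P′ , P′#B , trans (cong length grown) (length-snoc (vs P) u)

  gadget : ∀ b {x q r} (P : SimplePath x r) → Arc D x q → (Q : SimplePath q r) →
           (∀ u → u ∈ x ∷ vs P → u ∈ q ∷ vs Q → u ≡ r) →
           2 * b ∸ 1 ≤ length (vs P) → 2 * b ∸ 1 ≤ length (vs Q) → GadgetIII D b
  gadget b P a Q internal long₁ long₂ = record
    { p = _ ; q = _ ; r = _ ; pq = a ; P₁ = toPath P ; P₂ = toPath Q
    ; disj = internal ; len₁ = long₁ ; len₂ = long₂ }

module Construction (b h d : ℕ) (b≥1 : 1 ≤ b) (D : Digraph) (v : Vertex D)
  (deg : ∀ u → Reachable D v u → (h + 1) * (d * (2 * b ∸ 2) + 1) + d ≤ outdeg D u) where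

  open Paths D
  open DecMembership (_≟_ {n D}) using (_∈?_)

  -- Branches have L = M+1 arcs; each level adds K = dM+1 forbidden vertices;
  -- δ is the out-degree bound.
  M : ℕ
  M = 2 * b ∸ 2

  L : ℕ
  L = 2 * b ∸ 1

  K : ℕ
  K = d * M + 1

  δ : ℕ
  δ = (h + 1) * K + d

  L≡ : L ≡ suc M
  L≡ = 2b∸1≡suc b b≥1

  Conclusion : Set
  Conclusion = Σ (GadgetIII D b) λ G → Σ (Path D v (p G)) λ P₀ →
    (∀ u → u ∈P P₀ → u ∈G G → u ≡ p G) ×
    gsize G ≤ (2 * h + 2) * (2 * b ∸ 1) ×
    nverts P₀ ≤ h * (2 * b ∸ 1)

  record Anchor (x : V) (F : List V) : Set where
    field
      stem        : SimplePath v x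
      stem-inside : ∀ {u} → u ∈ v ∷ vs stem → u ≡ x ⊎ u ∈ F

  open Anchor public

  reroot : ∀ {x w F} → Anchor x F → (P : SimplePath x w) → Disjoint (vs P) F → SimplePath v w
  reroot α P P#F = join (stem α) P meet
    where
      meet : Disjoint (v ∷ vs (stem α)) (vs P)
      meet (u∈stem , u∈P) with stem-inside α u∈stem
      ... | inj₁ refl = start∉ P u∈P
      ... | inj₂ u∈F = P#F (u∈P , u∈F)

  degree : ∀ {x w F} → Anchor x F → (P : SimplePath x w) → Disjoint (vs P) F → δ ≤ outdeg D w
  degree α P P#F = deg _ (toPath (reroot α P P#F))

  -- Two internally disjoint x–r paths P, W avoiding F, with at least L and at
  -- least L+1 arcs, give the conclusion: W starts with an arc (x, q), and P
  -- together with the rest of W is a gadget meeting the stem only in x.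
  conclude : ∀ {x r F} (α : Anchor x F) → suc (length (vs (stem α))) ≤ h * L →
             (P W : SimplePath x r) → (∀ {u} → u ∈ vs P → u ∈ vs W → u ≡ r) →
             L ≤ length (vs P) → suc L ≤ length (vs W) →
             Disjoint (vs P) F → Disjoint (vs W) F →
             length (vs P) ≤ h * L → length (vs W) ≤ h * L → Conclusion
  conclude {x} {r} α short-stem P W@(simple (q ∷ ws) (a ◅ w) distinctW) meet longP (s≤s longW)
           P#F W#F boundP boundW =
    G , toPath (stem α) , stem∩G , gadget-size h L _ _ boundP boundW , short-stem
    where
      internal : ∀ u → u ∈ x ∷ vs P → u ∈ q ∷ ws → u ≡ r
      internal u (here refl) u∈W = ⊥-elim (start∉ W u∈W)
      internal u (there u∈P) u∈W = meet u∈P u∈W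

      G : GadgetIII D b
      G = gadget b P a (simple ws w (AllPairs.tail distinctW)) internal longP longW

      stem∩G : ∀ u → u ∈P toPath (stem α) → u ∈G G → u ≡ x
      stem∩G u u∈stem u∈G with stem-inside α u∈stem | u∈G
      ... | inj₁ u≡x | _ = u≡x
      ... | inj₂ _ | inj₁ (here u≡x) = u≡x
      ... | inj₂ u∈F | inj₁ (there u∈P) = ⊥-elim (P#F (u∈P , u∈F))
      ... | inj₂ u∈F | inj₂ u∈W = ⊥-elim (W#F (u∈W , u∈F))

  record Branch (x : V) (F : List V) : Set where
    field
      tip             : V
      interior        : List V
      path            : SimplePath x tip
      shape           : vs path ≡ interior ++ [ tip ]
      interior-length : length interior ≡ M
      branch-clear    : Disjoint (vs path) F

  open Branch public

  branch-length : ∀ {x F} (β : Branch x F) → length (vs (path β)) ≡ suc M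
  branch-length β =
    trans (cong length (shape β)) (trans (length-snoc (interior β) (tip β)) (cong suc (interior-length β)))

  interior⊆ : ∀ {x F} (β : Branch x F) {u} → u ∈ interior β → u ∈ vs (path β)
  interior⊆ β u∈ = subst (_ ∈_) (sym (shape β)) (∈-++⁺ˡ u∈)

  tip∈ : ∀ {x F} (β : Branch x F) → tip β ∈ vs (path β)
  tip∈ β = subst (_ ∈_) (sym (shape β)) (∈-++⁺ʳ (interior β) (here refl))

  interior-or-tip : ∀ {x F} (β : Branch x F) {u} → u ∈ vs (path β) → u ∈ interior β ⊎ u ≡ tip β
  interior-or-tip β u∈ = ∈-snoc (interior β) (subst (_ ∈_) (shape β) u∈)

  Apart : ∀ {x F} → Branch x F → Branch x F → Set
  Apart β γ = Disjoint (vs (path β)) (vs (path γ))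

  newBranch : ∀ {x F} → Anchor x F → (B : List V) → (∀ {u} → u ∈ F → u ∈ B) →
              length B + suc M < δ → Σ (Branch x F) λ β → Disjoint (vs (path β)) B
  newBranch {x} {F} α B F⊆B room = finish (greedyPath B M (λ P P#B → ≤-trans shorter (room′ P P#B)))
    where
      room′ : ∀ {w} (P : SimplePath x w) → Disjoint (vs P) B → length B + suc M < outdeg D w
      room′ P P#B = ≤-trans room (degree α P (disjoint-⊆ʳ P#B F⊆B))

      shorter : suc (length B + M) ≤ suc (length B + suc M)
      shorter = s≤s (+-monoʳ-≤ (length B) (n≤1+n M))

      finish : (Σ V λ w → Σ (SimplePath x w) λ P → Disjoint (vs P) B × length (vs P) ≡ M) →
               Σ (Branch x F) λ β → Disjoint (vs (path β)) B
      finish (w , P , P#B , |P|)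
        with extendOff B P P#B (subst (λ m → length B + suc m < outdeg D w) (sym |P|) (room′ P P#B))
      ... | u , P′ , grown , P′#B =
        record { tip = u ; interior = vs P ; path = P′ ; shape = grown ; interior-length = |P|
               ; branch-clear = disjoint-⊆ʳ P′#B F⊆B } , P′#B

  branchVerts : ∀ {x F} → List (Branch x F) → List V
  branchVerts = concatMap (λ β → vs (path β))

  room-for-branch : ∀ {x F t} (βs : List (Branch x F)) → length βs ≡ t → suc t ≤ d →
                    length F + K ≤ h * K → length (F ++ branchVerts βs) + suc M < δ
  room-for-branch {F = F} {t} βs |βs| t<d F-room =
    subst (λ m → m + suc M < δ) (sym size) (branch-room (length F) t d M h t<d F-room)
    where
      size : length (F ++ branchVerts βs) ≡ length F + t * suc M
      size = trans (length-++ F)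
        (cong (length F +_) (trans (length-concatMap _ branch-length βs) (cong (_* suc M) |βs|)))

  branches : ∀ {x F} → Anchor x F → length F + K ≤ h * K → (t : ℕ) → t ≤ d →
             Σ (List (Branch x F)) λ βs → length βs ≡ t × AllPairs Apart βs
  branches α F-room zero _ = [] , refl , []
  branches {x} {F} α F-room (suc t) t<d = addTo (branches α F-room t (≤-trans (n≤1+n t) t<d))
    where
      addTo : (Σ (List (Branch x F)) λ βs → length βs ≡ t × AllPairs Apart βs) →
              Σ (List (Branch x F)) λ βs → length βs ≡ suc t × AllPairs Apart βs
      addTo (βs , |βs| , apart) = β ∷ βs , cong suc |βs| , All.tabulate β#γ ∷ apart
        where
          new : Σ (Branch x F) λ β → Disjoint (vs (path β)) (F ++ branchVerts βs)
          new = newBranch α (F ++ branchVerts βs) ∈-++⁺ˡ (room-for-branch βs |βs| t<d F-room)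
          β : Branch x F
          β = proj₁ new

          β#γ : ∀ {γ} → γ ∈ βs → Apart β γ
          β#γ γ∈ (u∈β , u∈γ) = proj₂ new (u∈β , ∈-++⁺ʳ F (∈-concatMap _ γ∈ u∈γ))

  record Reach (x : V) (F : List V) (k : ℕ) : Set where
    constructor reach
    field
      target      : V
      route       : SimplePath x target
      short       : length (vs route) ≤ k * L
      route-clear : Disjoint (vs route) F

  open Reach public

  Outcome : V → List V → ℕ → Set
  Outcome x F k =
    Conclusion ⊎ Σ (List (Reach x F k)) λ rs → AllPairs (λ r s → target r ≢ target s) rs × d ^ k ≤ length rs

  module Level (k : ℕ) {x : V} {F : List V} (α : Anchor x F)
               (stem-room : length (vs (stem α)) + suc k * L ≤ h * L)
               (βs : List (Branch x F)) (apart : AllPairs Apart βs) where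

    F′ : List V
    F′ = F ++ x ∷ concatMap interior βs

    x∈F′ : x ∈ F′
    x∈F′ = ∈-++⁺ʳ F (here refl)

    F⊆F′ : ∀ {u} → u ∈ F → u ∈ F′
    F⊆F′ = ∈-++⁺ˡ

    interior⊆F′ : ∀ {β u} → β ∈ βs → u ∈ interior β → u ∈ F′
    interior⊆F′ β∈ u∈ = ∈-++⁺ʳ F (there (∈-concatMap interior β∈ u∈))

    route-bound : suc k * L ≤ h * L
    route-bound = ≤-trans (m≤n+m (suc k * L) (length (vs (stem α)))) stem-room

    stem-short : suc (length (vs (stem α))) ≤ h * L
    stem-short = ≤-trans (≤-reflexive (+-comm 1 _)) (≤-trans (+-monoʳ-≤ _ 1≤) stem-room)
      where
        1≤ : 1 ≤ suc k * L
        1≤ = ≤-trans (subst (1 ≤_) (sym L≡) (s≤s z≤n)) (m≤m+n L (k * L))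

    childAnchor : ∀ {β} → β ∈ βs → Anchor (tip β) F′
    childAnchor {β} β∈ = record { stem = reroot α (path β) (branch-clear β) ; stem-inside = inside }
      where
        inside : ∀ {u} → u ∈ v ∷ (vs (stem α) ++ vs (path β)) → u ≡ tip β ⊎ u ∈ F′
        inside u∈ with ∈-++⁻ (v ∷ vs (stem α)) u∈
        ... | inj₁ u∈stem with stem-inside α u∈stem
        ...   | inj₁ refl = inj₂ x∈F′
        ...   | inj₂ u∈F = inj₂ (F⊆F′ u∈F)
        inside u∈ | inj₂ u∈β with interior-or-tip β u∈β
        ...   | inj₁ u∈I = inj₂ (interior⊆F′ β∈ u∈I)
        ...   | inj₂ u≡tip = inj₁ u≡tip

    child-stem-room : ∀ {β} (β∈ : β ∈ βs) → length (vs (stem (childAnchor β∈))) + k * L ≤ h * L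
    child-stem-room {β} β∈ = subst (_≤ h * L) (sym regroup) stem-room
      where
        regroup : length (vs (stem α) ++ vs (path β)) + k * L ≡ length (vs (stem α)) + suc k * L
        regroup = trans (cong (_+ k * L) (trans (length-++ (vs (stem α)))
                          (cong (length (vs (stem α)) +_) (trans (branch-length β) (sym L≡)))))
                        (+-assoc (length (vs (stem α))) L (k * L))

    child-F-room : length βs ≡ d → length F + suc k * K ≤ h * K → length F′ + k * K ≤ h * K
    child-F-room |βs| F-room = subst (_≤ h * K) (sym regroup) F-room
      where
        interiors : length (concatMap interior βs) ≡ d * M
        interiors = trans (length-concatMap interior interior-length βs) (cong (_* M) |βs|)

        regroup : length F′ + k * K ≡ length F + suc k * K
        regroup = trans (cong (λ m → m + k * K) (trans (length-++ F) (cong (λ m → length F + suc m) interiors)))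
          (solve 3 (λ f dM kK → f :+ (con 1 :+ dM) :+ kK := f :+ ((dM :+ con 1) :+ kK)) refl (length F) (d * M) (k * K))

    lift : ∀ {β} → β ∈ βs → Reach (tip β) F′ k → Reach x F (suc k)
    lift {β} β∈ (reach z S short S#F′) = reach z (join (path β) S meet) bound clear
      where
        meet : Disjoint (x ∷ vs (path β)) (vs S)
        meet (here refl , u∈S) = S#F′ (u∈S , x∈F′)
        meet (there u∈β , u∈S) with interior-or-tip β u∈β
        ... | inj₁ u∈I = S#F′ (u∈S , interior⊆F′ β∈ u∈I)
        ... | inj₂ refl = start∉ S u∈S

        bound : length (vs (path β) ++ vs S) ≤ suc k * L
        bound = ≤-trans (≤-reflexive (trans (length-++ (vs (path β)))
                                        (cong (_+ length (vs S)) (trans (branch-length β) (sym L≡)))))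
                        (+-monoʳ-≤ L short)

        clear : Disjoint (vs (path β) ++ vs S) F
        clear (u∈ , u∈F) with ∈-++⁻ (vs (path β)) u∈
        ... | inj₁ u∈β = branch-clear β (u∈β , u∈F)
        ... | inj₂ u∈S = S#F′ (u∈S , F⊆F′ u∈F)

    off-interior : ∀ {β γ} (β∈ : β ∈ βs) → γ ∈ βs → Apart β γ → (S : Reach (tip β) F′ k) →
                   ∀ {u} → u ∈ vs (route (lift β∈ S)) → u ∉ interior γ
    off-interior {β} {γ} β∈ γ∈ β#γ S u∈ u∈I with ∈-++⁻ (vs (path β)) u∈
    ... | inj₁ u∈β = β#γ (u∈β , interior⊆ γ u∈I)
    ... | inj₂ u∈S = route-clear S (u∈S , interior⊆F′ γ∈ u∈I)

    past-interior : ∀ {β} (β∈ : β ∈ βs) (S : Reach (tip β) F′ k) {pre r post} →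
                    vs (route (lift β∈ S)) ≡ pre ++ r ∷ post → r ∉ interior β → L ≤ length (pre ++ [ r ])
    past-interior {β} β∈ S {pre} {r} {post} split r∉I =
      subst (_≤ length (pre ++ [ r ])) (trans (cong suc (interior-length β)) (sym L≡))
        (prefix-beyond (interior β) (tip β ∷ vs (route S)) pre post (trans regroup split) r∉I)
      where
        regroup : interior β ++ tip β ∷ vs (route S) ≡ vs (path β) ++ vs (route S)
        regroup = trans (split-at (interior β) (tip β) (vs (route S))) (cong (_++ vs (route S)) (sym (shape β)))

    past-branch : ∀ {β} (β∈ : β ∈ βs) (S : Reach (tip β) F′ k) {pre r post} →
                  vs (route (lift β∈ S)) ≡ pre ++ r ∷ post → r ∉ vs (path β) → suc L ≤ length (pre ++ [ r ])
    past-branch {β} β∈ S {pre} {r} {post} split r∉β =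
      subst (_≤ length (pre ++ [ r ])) (cong suc (trans (branch-length β) (sym L≡)))
        (prefix-beyond (vs (path β)) (vs (route S)) pre post split r∉β)

    segment-clear : (R : Reach x F (suc k)) → ∀ {pre r post} (e : vs (route R) ≡ pre ++ r ∷ post) →
                    Disjoint (vs (prefix (route R) e)) F
    segment-clear R e (u∈ , u∈F) = route-clear R (prefix-⊆ (route R) e u∈ , u∈F)

    segment-short : (R : Reach x F (suc k)) → ∀ {pre r post} (e : vs (route R) ≡ pre ++ r ∷ post) →
                    length (vs (prefix (route R) e)) ≤ h * L
    segment-short R e = ≤-trans (prefix-≤ (route R) e) (≤-trans (short R) route-bound)

    -- Routes through two apart branches reaching the same target give the
    -- conclusion: cut both at their first common vertex r.  Then r is off both
    -- interiors and off at least one of the branches, so one segment has at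
    -- least L arcs and the other at least L+1.
    collide : ∀ {β₁ β₂} (β₁∈ : β₁ ∈ βs) (β₂∈ : β₂ ∈ βs) → Apart β₁ β₂ →
              (S₁ : Reach (tip β₁) F′ k) (S₂ : Reach (tip β₂) F′ k) → target S₁ ≡ target S₂ → Conclusion
    collide {β₁} {β₂} β₁∈ β₂∈ β₁#β₂ S₁ S₂ same = decide (common ∈? vs (path β₂))
      where
        R₁ R₂ : Reach x F (suc k)
        R₁ = lift β₁∈ S₁
        R₂ = lift β₂∈ S₂

        z∈R₁ : target S₂ ∈ vs (route R₁)
        z∈R₁ = subst (_∈ vs (route R₁)) same (end∈join (path β₁) (route S₁) (tip∈ β₁))

        z∈R₂ : target S₂ ∈ vs (route R₂)
        z∈R₂ = end∈join (path β₂) (route S₂) (tip∈ β₂)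

        open FirstCommon (firstCommon _≟_ (vs (route R₁)) (vs (route R₂)) z∈R₁ z∈R₂)

        A B : SimplePath x common
        A = prefix (route R₁) splitX
        B = prefix (route R₂) splitY

        meet : ∀ {u} → u ∈ vs A → u ∈ vs B → u ≡ common
        meet u∈A u∈B with ∈-snoc preY u∈B
        ... | inj₁ u∈preY = ⊥-elim (All.lookup early u∈preY (prefix-⊆ (route R₁) splitX u∈A))
        ... | inj₂ u≡common = u≡common

        common∈R₁ : common ∈ vs (route R₁)
        common∈R₁ = subst (common ∈_) (sym splitX) (∈-++⁺ʳ preX (here refl))

        common∈R₂ : common ∈ vs (route R₂)
        common∈R₂ = subst (common ∈_) (sym splitY) (∈-++⁺ʳ preY (here refl))

        decide : Dec (common ∈ vs (path β₂)) → Conclusion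
        decide (yes common∈β₂) =
          conclude α stem-short B A (λ u∈B u∈A → meet u∈A u∈B)
            (past-interior β₂∈ S₂ splitY (off-interior β₁∈ β₂∈ β₁#β₂ S₁ common∈R₁))
            (past-branch β₁∈ S₁ splitX (λ common∈β₁ → β₁#β₂ (common∈β₁ , common∈β₂)))
            (segment-clear R₂ splitY) (segment-clear R₁ splitX)
            (segment-short R₂ splitY) (segment-short R₁ splitX)
        decide (no common∉β₂) =
          conclude α stem-short A B meet
            (past-interior β₁∈ S₁ splitX (off-interior β₂∈ β₁∈ (DisjointP.sym β₁#β₂) S₂ common∈R₂))
            (past-branch β₂∈ S₂ splitY common∉β₂)
            (segment-clear R₁ splitX) (segment-clear R₂ splitY)
            (segment-short R₁ splitX) (segment-short R₂ splitY)

    Tagged : List (Branch x F) → Set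
    Tagged γs = Σ (Branch x F) λ γ → γ ∈ γs × Reach (tip γ) F′ k

    tag-target : ∀ {γs} → Tagged γs → V
    tag-target (_ , _ , R) = target R

    module Merge (children : ∀ {β} → β ∈ βs → Outcome (tip β) F′ k) where

      merge : (γs : List (Branch x F)) → AllPairs Apart γs → (∀ {γ} → γ ∈ γs → γ ∈ βs) →
              Conclusion ⊎ Σ (List (Tagged γs)) λ ts →
                AllPairs (λ t t′ → tag-target t ≢ tag-target t′) ts × length γs * d ^ k ≤ length ts
      merge [] [] _ = inj₂ ([] , [] , z≤n)
      merge (γ ∷ γs) (γ#γs ∷ apart′) sub with merge γs apart′ (λ γ∈ → sub (there γ∈)) | children (sub (here refl))
      ... | inj₁ c | _ = inj₁ c
      ... | inj₂ _ | inj₁ c = inj₁ c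
      ... | inj₂ (ts , distinct-ts , many-ts) | inj₂ (rs , distinct-rs , many-rs)
        with keyClash _≟_ target tag-target rs ts
      ...   | inj₁ (R , (γ′ , γ′∈ , R′) , same) =
        inj₁ (collide (sub (here refl)) (sub (there γ′∈)) (All.lookup γ#γs γ′∈) R R′ same)
      ...   | inj₂ cross =
        inj₂ (map here-tag rs ++ map there-tag ts
             , AllPairsP.++⁺ (AllPairsP.map⁺ distinct-rs) (AllPairsP.map⁺ distinct-ts)
                             (AllP.map⁺ (All.map AllP.map⁺ cross))
             , counted)
        where
          here-tag : Reach (tip γ) F′ k → Tagged (γ ∷ γs)
          here-tag R = γ , here refl , R

          there-tag : Tagged γs → Tagged (γ ∷ γs)
          there-tag (γ′ , γ′∈ , R) = γ′ , there γ′∈ , R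

          counted : suc (length γs) * d ^ k ≤ length (map here-tag rs ++ map there-tag ts)
          counted = subst (_ ≤_)
            (sym (trans (length-++ (map here-tag rs)) (cong₂ _+_ (length-map here-tag rs) (length-map there-tag ts))))
            (+-mono-≤ many-rs many-ts)

      combine : length βs ≡ d → Outcome x F (suc k)
      combine |βs| with merge βs apart (λ β∈ → β∈)
      ... | inj₁ c = inj₁ c
      ... | inj₂ (ts , distinct-ts , many) = inj₂ (map lift-tagged ts , AllPairsP.map⁺ distinct-ts , counted)
        where
          lift-tagged : Tagged βs → Reach x F (suc k)
          lift-tagged (_ , β∈ , R) = lift β∈ R

          counted : d ^ suc k ≤ length (map lift-tagged ts)
          counted = subst (d ^ suc k ≤_) (sym (length-map lift-tagged ts))
                      (subst (λ m → m * d ^ k ≤ length ts) |βs| many)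

  -- The tree of height k below an anchored x; the two budgets bound the length
  -- of routes and the size of the forbidden set.
  tree : (k : ℕ) {x : V} {F : List V} (α : Anchor x F) →
         length (vs (stem α)) + k * L ≤ h * L → length F + k * K ≤ h * K → Outcome x F k
  tree zero {x} α _ _ = inj₂ ([ reach x trivial z≤n (λ { (() , _) }) ] , [] ∷ [] , ≤-refl)
  tree (suc k) {F = F} α stem-room F-room with branches α (≤-trans (+-monoʳ-≤ (length F) (m≤m+n K (k * K))) F-room) d ≤-refl
  ... | βs , |βs| , apart =
    Merge.combine (λ β∈ → tree k (childAnchor β∈) (child-stem-room β∈) (child-F-room |βs| F-room)) |βs|
    where open Level k α stem-room βs apart

  root : Anchor v []
  root = record { stem = trivial ; stem-inside = λ { (here v≡) → inj₁ v≡ } }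

lemma2p11 : (b h d : ℕ) → 1 ≤ b → 1 ≤ h → 1 ≤ d →
    (D : Digraph) (v : Vertex D) →
    (∀ u → Reachable D v u → (h + 1) * (d * (2 * b ∸ 2) + 1) + d ≤ outdeg D u) →
    FewerThan D (λ u → DistLe D v u ((h + 1) * (2 * b ∸ 1))) (d ^ h) →
    Σ (GadgetIII D b) λ G → Σ (Path D v (p G)) λ P₀ →
    (∀ u → u ∈P P₀ → u ∈G G → u ≡ p G) ×
    gsize G ≤ (2 * h + 2) * (2 * b ∸ 1) ×
    nverts P₀ ≤ h * (2 * b ∸ 1)
lemma2p11 b h d b≥1 _ _ D v deg few = fromOutcome (tree h root ≤-refl ≤-refl)
  where
    open Paths D
    open Construction b h d b≥1 D v deg

    inBall : (R : Reach v [] h) → DistLe D v (target R) ((h + 1) * L)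
    inBall R = toPath (route R) , ≤-trans (short R) (*-monoˡ-≤ L (m≤m+n h 1))

    fromOutcome : Outcome v [] h → Conclusion
    fromOutcome (inj₁ found) = found
    fromOutcome (inj₂ (rs , distinct , many)) =
      ⊥-elim (<⇒≱ (few (map target rs) (AllPairsP.map⁺ distinct) (AllP.map⁺ (All.tabulate (λ {R} _ → inBall R))))
                  (subst (d ^ h ≤_) (sym (length-map target rs)) many))
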